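{- Let $m$ be a positive integer and $n = 2m$. If $m$ is sufficiently large, then the deterministic query complexity of $f_{n,m}$ satisfies $D(f_{n,m}) \ge m^2$.
   Context: Let $n,m$ be positive integers, $M=[n]\times[m]$ a grid of cells $(i,j)$ (row $i$, column $j$), $\widetilde M = M\cup\{\bot\}$ (pointers to cells, $\bot$ the null pointer) and $\widetilde C=[m]\cup\{\bot\}$ (pointers to columns). Let $T$ be the following rooted binary tree with $m$ leaves and $m-1$ internal nodes, each internal node having a left and a right child: if $m=2^k$, $T$ is the complete binary tree of depth $k$; if $2^k<m<2^{k+1}$, take the complete binary tree with $2^k$ leaves and attach a pair of children to each of its $m-2^k$ leftmost leaves. The leaves are labelled $1,\dots,m$ from left to right; for a leaf $j$, $T(j)$ denotes the sequence of "left"/"right" steps from the root to leaf $j$. The alphabet is $\Sigma=\{0,1\}\times\widetilde M\times\widetilde M\times\widetilde C$; for $v=(v_1,v_2,v_3,v_4)\in\Sigma$ write $\mathrm{val}(v)=v_1$, $\mathrm{lpoint}(v)=v_2$, $\mathrm{rpoint}(v)=v_3$, $\mathrm{bpoint}(v)=v_4$. The function $f_{n,m}\colon\Sigma^M\to\{0,1\}$ is defined by $f_{n,m}(x)=1$ iff: (1) there is exactly one column $b$ with $\mathrm{val}(x_{i,b})=1$ for all $i\in[n]$ (the marked column); (2) there is a unique cell $a$ in column $b$ with $x_a\ne(1,\bot,\bot,\bot)$ (the special element); (3) for each column $j\ne b$, the path starting at $a$ and following $\mathrm{lpoint}$/$\mathrm{rpoint}$ as specified by $T(j)$ never meets a $\bot$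 pointer, and its endpoint $\ell_j$ lies in column $j$ and has $\mathrm{val}(x_{\ell_j})=0$; (4) for each $j\ne b$, $\mathrm{bpoint}(x_{\ell_j})=b$. Query model: an algorithm accesses $x\in\Sigma^M$ by queries, each query returning the full element $x_{i,j}\in\Sigma$. $D(f)$ is the minimum, over deterministic decision trees computing $f$ on all inputs, of the maximum number of queries on any input. -}

module Defs where

open import Data.Nat using (ℕ; zero; suc; _+_; _*_; _∸_; _^_; _≤_; _<_; _%_; ⌊_/2⌋)
open import Data.Nat.Logarithm using (⌊log₂_⌋)
open import Data.Bool using (Bool; true; false; if_then_else_)
open import Data.Nat using (_<ᵇ_)
open import Data.Fin using (Fin; toℕ)
open import Data.Maybe using (Maybe; just; nothing)
open import Data.List using (List; []; _∷_; _∷ʳ_)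
open import Data.Product using (_×_; _,_; proj₁; proj₂; Σ; ∃; ∃-syntax)
open import Relation.Binary.PropositionalEquality using (_≡_; _≢_)

data Dir : Set where
  left right : Dir

-- Path (MSB first, 0 = left) to leaf p (0-based, left to right) of the
-- complete binary tree of depth k.
completePath : ℕ → ℕ → List Dir
completePath zero    p = []
completePath (suc k) p =
  completePath k ⌊ p /2⌋ ∷ʳ (if p % 2 Data.Nat.≡ᵇ 0 then left else right)

-- T(j) for the tree T with m leaves, leaf index j (0-based, i.e. leaf j+1
-- in the paper's 1-based labelling).  With k = ⌊log₂ m⌋ and r = m - 2^k,
-- the r leftmost leaves of the complete tree with 2^k leaves each get two
-- children; so leaves 0..2r-1 of T are children of complete-tree leaves
-- 0..r-1, and leaf j ≥ 2r of T is complete-tree leaf j - r.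
treePath : (m : ℕ) → ℕ → List Dir
treePath m j =
  let k = ⌊log₂ m ⌋
      r = m ∸ 2 ^ k
  in if j <ᵇ (2 * r)
     then completePath k ⌊ j /2⌋ ∷ʳ (if j % 2 Data.Nat.≡ᵇ 0 then left else right)
     else completePath k (j ∸ r)

T : (m : ℕ) → Fin m → List Dir
T m j = treePath m (toℕ j)

Cell : ℕ → ℕ → Set
Cell n m = Fin n × Fin m

col : ∀ {n m} → Cell n m → Fin m
col = proj₂

-- Σ = {0,1} × M̃ × M̃ × C̃, with ⊥ represented by nothing, 1 by true.
Sym : ℕ → ℕ → Set
Sym n m = Bool × Maybe (Cell n m) × Maybe (Cell n m) × Maybe (Fin m)

val : ∀ {n m} → Sym n m → Bool
val (v , _ , _ , _) = v

lpoint : ∀ {n m} → Sym n m → Maybe (Cell n m)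
lpoint (_ , l , _ , _) = l

rpoint : ∀ {n m} → Sym n m → Maybe (Cell n m)
rpoint (_ , _ , r , _) = r

bpoint : ∀ {n m} → Sym n m → Maybe (Fin m)
bpoint (_ , _ , _ , b) = b

Input : ℕ → ℕ → Set
Input n m = Cell n m → Sym n m

plain : ∀ {n m} → Sym n m
plain = true , nothing , nothing , nothing

step : ∀ {n m} → Dir → Sym n m → Maybe (Cell n m)
step left  = lpoint
step right = rpoint

follow : ∀ {n m} → Input n m → Cell n m → List Dir → Maybe (Cell n m)
follow x c []       = just c
follow x c (d ∷ ds) with step d (x c)
... | nothing = nothing
... | just c' = follow x c' ds

-- The function f_{n,m}, as the proposition "f_{n,m}(x) = 1".

record FValue {n m : ℕ} (x : Input n m) : Set where
  field
    b          : Fin m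
    marked     : ∀ i → val (x (i , b)) ≡ true
    markedUniq : ∀ j → (∀ i → val (x (i , j)) ≡ true) → j ≡ b
    a          : Fin n
    special    : x (a , b) ≢ plain
    specialUniq : ∀ i → x (i , b) ≢ plain → i ≡ a
    paths      : ∀ j → j ≢ b →
                 ∃[ ℓ ] (follow x (a , b) (T m j) ≡ just ℓ
                         × col ℓ ≡ j
                         × val (x ℓ) ≡ false
                         × bpoint (x ℓ) ≡ just b)

f : ∀ {n m} → Input n m → Set
f = FValue

data DTree (n m : ℕ) : Set where
  leaf  : Bool → DTree n m
  query : Cell n m → (Sym n m → DTree n m) → DTree n m

eval : ∀ {n m} → DTree n m → Input n m → Bool
eval (leaf o)    x = o
eval (query c k) x = eval (k (x c)) x

cost : ∀ {n m} → DTree n m → Input n m → ℕ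
cost (leaf o)    x = 0
cost (query c k) x = suc (cost (k (x c)) x)

Computes : ∀ {n m} → DTree n m → Set
Computes {n} {m} t = ∀ (x : Input n m) → (eval t x ≡ true → f x) × (f x → eval t x ≡ true)

module Submission where

open import Defs
open import Data.Nat using (ℕ; _*_; _≤_; _<_)
open import Data.Product using (∃-syntax; _×_)
open import Data.Nat using (zero; suc; _+_; _∸_; _^_; z≤n; s≤s; _<ᵇ_; _≡ᵇ_; ⌊_/2⌋; _%_; _<?_; _≤?_; s≤s⁻¹)
open import Data.Nat.Properties
open import Algebra.Properties.CommutativeSemigroup +-commutativeSemigroup using (x∙yz≈y∙xz)
open import Data.Nat.Logarithm using (⌊log₂_⌋; ⌊log₂⌋-mono-≤; ⌊log₂⌊n/2⌋⌋≡⌊log₂n⌋∸1)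
open import Data.Nat.Induction using (<-rec)
open import Data.Nat.DivMod using (m%n<n)
open import Data.Nat.Tactic.RingSolver using (solve-∀)
open import Data.Product using (_,_; proj₁; proj₂)
open import Data.Product.Properties using (≡-dec)
open import Data.Sum using (_⊎_; inj₁; inj₂)
open import Data.List using (List; []; _∷_; _++_; map; length; filter; _∷ʳ_; allFin; cartesianProduct)
open import Data.Nat.ListAction using (sum)
open import Data.List.Properties using (length-++; length-map; length-tabulate; filter-none)
open import Data.List.Membership.Propositional using (_∈_; _∉_)
open import Data.List.Membership.Propositional.Properties
open import Data.List.Relation.Binary.Subset.Propositional using (_⊆_)
open import Data.List.Relation.Unary.Any using (here; there)
open import Data.List.Relation.Unary.All as All using (All; []; _∷_)
open import Data.List.Relation.Unary.All.Properties using (¬Any⇒All¬)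
open import Data.List.Relation.Unary.AllPairs using ([]; _∷_)
open import Data.List.Relation.Unary.Unique.Propositional using (Unique)
open import Data.List.Relation.Unary.Unique.Propositional.Properties using (allFin⁺; filter⁺; map⁺; cartesianProduct⁺)
open import Relation.Binary.PropositionalEquality
open import Relation.Nullary using (¬_; Dec; yes; no)
open import Relation.Nullary.Decidable using (¬?; _×-dec_)
open import Relation.Unary using (Pred; Decidable)
open import Data.Empty using (⊥-elim)
open import Data.Maybe using (Maybe; just; nothing)
open import Data.Bool using (true; false; if_then_else_) renaming (T to True)
open import Data.Fin using (Fin; toℕ; fromℕ<)
import Data.Fin.Properties as Fin
open import Function using (id; case_of_)

-- Adversary argument, valid for every m ≥ 3.  The adversary answers the
-- k-th query into a column (from 0) with the plain symbol (1,⊥,⊥,⊥) while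
-- k < m, and later with a 0-cell whose bpoint is column k - m.  Let H be the
-- history of a run of t against it.  If t made fewer than m² queries, two
-- inputs extend H:  x₀, which is (0,⊥,⊥,⊥) on unqueried cells, has f = 0,
-- since a marked column would be fully queried and its query number m was
-- answered by a 0-cell;  x₁ has f = 1: by pigeonhole a column b received
-- fewer than m (plain) answers and is marked, an unqueried cell a of b is
-- special, each column j ≠ b has a leaf pointing to b (unqueried, or the
-- cell answered for k = m + b), and m - 2 unqueried cells outside b carry
-- the internal nodes of T, laid out as a heap.  As t answers alike on both,
-- it does not compute f.

module _ {a} {A : Set a} where

  unique-⊆⇒length-≤ : ∀ {xs ys : List A} → Unique xs → xs ⊆ ys → length xs ≤ length ys
  unique-⊆⇒length-≤ {[]} _ _ = z≤n
  unique-⊆⇒length-≤ {x ∷ xs} {ys} (x∉xs ∷ uxs) sub with ∈-∃++ (sub (here refl))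
  ... | us , vs , refl = begin
    suc (length xs)            ≤⟨ s≤s (unique-⊆⇒length-≤ uxs sub′) ⟩
    suc (length (us ++ vs))    ≡⟨ cong suc (length-++ us) ⟩
    suc (length us + length vs) ≡⟨ +-suc (length us) (length vs) ⟨
    length us + suc (length vs) ≡⟨ length-++ us ⟨
    length (us ++ x ∷ vs)      ∎
    where
    open ≤-Reasoning
    sub′ : xs ⊆ us ++ vs
    sub′ z∈xs with ∈-++⁻ us (sub (there z∈xs))
    ... | inj₁ z∈us         = ∈-++⁺ˡ z∈us
    ... | inj₂ (here refl)  = ⊥-elim (All.lookup x∉xs z∈xs refl)
    ... | inj₂ (there z∈vs) = ∈-++⁺ʳ us z∈vs

  length-filter-partition : ∀ {p} {P : Pred A p} (P? : Decidable P) xs →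
    length (filter P? xs) + length (filter (λ x → ¬? (P? x)) xs) ≡ length xs
  length-filter-partition P? [] = refl
  length-filter-partition P? (x ∷ xs) with P? x
  ... | yes _ = cong suc (length-filter-partition P? xs)
  ... | no _  = trans (+-suc _ _) (cong suc (length-filter-partition P? xs))

  nth : List A → A → ℕ → A
  nth []       d _       = d
  nth (x ∷ xs) d zero    = x
  nth (x ∷ xs) d (suc i) = nth xs d i

  nth-∈ : ∀ xs d i → i < length xs → nth xs d i ∈ xs
  nth-∈ (x ∷ xs) d zero    _         = here refl
  nth-∈ (x ∷ xs) d (suc i) (s≤s i<) = there (nth-∈ xs d i i<)

  nth-injective : ∀ xs d {i i′} → Unique xs → i < length xs → i′ < length xs →
                  nth xs d i ≡ nth xs d i′ → i ≡ i′
  nth-injective (x ∷ xs) d {zero}  {zero}   _          _         _          _  = refl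
  nth-injective (x ∷ xs) d {zero}  {suc i′} (x∉ ∷ _)   _         (s≤s i′<) eq =
    ⊥-elim (All.lookup x∉ (nth-∈ xs d i′ i′<) eq)
  nth-injective (x ∷ xs) d {suc i} {zero}   (x∉ ∷ _)   (s≤s i<) _          eq =
    ⊥-elim (All.lookup x∉ (nth-∈ xs d i i<) (sym eq))
  nth-injective (x ∷ xs) d {suc i} {suc i′} (_ ∷ uxs) (s≤s i<) (s≤s i′<) eq =
    cong suc (nth-injective xs d uxs i< i′< eq)

length-cartesianProduct : ∀ {a b} {A : Set a} {B : Set b} (xs : List A) (ys : List B) →
                          length (cartesianProduct xs ys) ≡ length xs * length ys
length-cartesianProduct []       ys = refl
length-cartesianProduct (x ∷ xs) ys = begin
  length (map (x ,_) ys ++ cartesianProduct xs ys)        ≡⟨ length-++ (map (x ,_) ys) ⟩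
  length (map (x ,_) ys) + length (cartesianProduct xs ys) ≡⟨ cong₂ _+_ (length-map (x ,_) ys) (length-cartesianProduct xs ys) ⟩
  length ys + length xs * length ys                       ∎
  where open ≡-Reasoning

length-allFin : ∀ k → length (allFin k) ≡ k
length-allFin k = length-tabulate {n = k} id

-- The list of all cells of the n × m grid.  It is kept opaque: only its
-- two properties below are needed, and unfolding it is expensive.
opaque
  grid : (n m : ℕ) → List (Cell n m)
  grid n m = cartesianProduct (allFin n) (allFin m)

  grid-unique : ∀ n m → Unique (grid n m)
  grid-unique n m = cartesianProduct⁺ (allFin⁺ n) (allFin⁺ m)

  length-grid : ∀ n m → length (grid n m) ≡ n * m
  length-grid n m = trans (length-cartesianProduct (allFin n) (allFin m))
                          (cong₂ _*_ (length-allFin n) (length-allFin m))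

module LabelCounting {a} {A : Set a} {k : ℕ} (label : A → Fin k) where

  withLabel : Fin k → List A → List A
  withLabel j = filter (λ x → label x Fin.≟ j)

  occurrences : Fin k → List A → ℕ
  occurrences j xs = length (withLabel j xs)

  total : List (Fin k) → List A → ℕ
  total js xs = sum (map (λ j → occurrences j xs) js)

  hits : Fin k → List (Fin k) → ℕ
  hits i js = length (filter (i Fin.≟_) js)

  hits-unique : ∀ i js → Unique js → hits i js ≤ 1
  hits-unique i []       _            = z≤n
  hits-unique i (j ∷ js) (j∉js ∷ ujs) with i Fin.≟ j
  ... | yes refl = s≤s (≤-reflexive (cong length (filter-none (i Fin.≟_) j∉js)))
  ... | no _     = hits-unique i js ujs

  total-∷ : ∀ js x xs → total js (x ∷ xs) ≡ hits (label x) js + total js xs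
  total-∷ []       x xs = refl
  total-∷ (j ∷ js) x xs with label x Fin.≟ j
  ... | yes _ = cong suc (trans (cong (occurrences j xs +_) (total-∷ js x xs))
                                (x∙yz≈y∙xz (occurrences j xs) (hits (label x) js) (total js xs)))
  ... | no _  = trans (cong (occurrences j xs +_) (total-∷ js x xs))
                      (x∙yz≈y∙xz (occurrences j xs) (hits (label x) js) (total js xs))

  total-unique : ∀ js xs → Unique js → total js xs ≤ length xs
  total-unique js []       _   = ≤-reflexive (total-[] js)
    where
    total-[] : ∀ js′ → total js′ [] ≡ 0
    total-[] []        = refl
    total-[] (_ ∷ js′) = total-[] js′
  total-unique js (x ∷ xs) ujs = begin
    total js (x ∷ xs)                   ≡⟨ total-∷ js x xs ⟩
    hits (label x) js + total js xs     ≤⟨ +-mono-≤ (hits-unique (label x) js ujs) (total-unique js xs ujs) ⟩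
    suc (length xs)                      ∎
    where open ≤-Reasoning

  rare-label : ∀ q xs → length xs < k * q → ∃[ j ] occurrences j xs < q
  rare-label q xs short with Fin.any? (λ j → occurrences j xs <? q)
  ... | yes rare = rare
  ... | no ¬rare = ⊥-elim (<⇒≱ short (begin
    k * q                        ≡⟨ cong (_* q) (length-allFin k) ⟨
    length (allFin k) * q        ≤⟨ total-lower (allFin k) ⟩
    total (allFin k) xs          ≤⟨ total-unique (allFin k) xs (allFin⁺ k) ⟩
    length xs                    ∎))
    where
    open ≤-Reasoning
    total-lower : ∀ js → length js * q ≤ total js xs
    total-lower []       = z≤n
    total-lower (j ∷ js) = +-mono-≤ (≮⇒≥ (λ o<q → ¬rare (j , o<q))) (total-lower js)

parity : ∀ p → (p % 2 ≡ 0 × 2 * ⌊ p /2⌋ ≡ p) ⊎ (p % 2 ≡ 1 × 1 + 2 * ⌊ p /2⌋ ≡ p)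
parity zero          = inj₁ (refl , refl)
parity (suc zero)    = inj₂ (refl , refl)
parity (suc (suc p)) with parity p
... | inj₁ (p%2 , eq) = inj₁ (p%2 , trans (*-suc 2 ⌊ p /2⌋) (cong (2 +_) eq))
... | inj₂ (p%2 , eq) = inj₂ (p%2 , cong suc (trans (*-suc 2 ⌊ p /2⌋) (cong (1 +_) eq)))

halve-decomposition : ∀ p → 2 * ⌊ p /2⌋ + p % 2 ≡ p
halve-decomposition p with parity p
... | inj₁ (p%2 , eq) rewrite p%2 = trans (+-identityʳ _) eq
... | inj₂ (p%2 , eq) rewrite p%2 = trans (+-comm _ 1) eq

2⌊p/2⌋≤p : ∀ p → 2 * ⌊ p /2⌋ ≤ p
2⌊p/2⌋≤p p = subst (2 * ⌊ p /2⌋ ≤_) (halve-decomposition p) (m≤m+n _ _)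

p<2[1+⌊p/2⌋] : ∀ p → p < 2 * suc ⌊ p /2⌋
p<2[1+⌊p/2⌋] p = begin-strict
  p                         ≡⟨ halve-decomposition p ⟨
  2 * ⌊ p /2⌋ + p % 2      <⟨ +-monoʳ-< (2 * ⌊ p /2⌋) (m%n<n p 2) ⟩
  2 * ⌊ p /2⌋ + 2          ≡⟨ trans (*-suc 2 ⌊ p /2⌋) (+-comm 2 _) ⟨
  2 * suc ⌊ p /2⌋           ∎
  where open ≤-Reasoning

⌊p/2⌋<q : ∀ p q → p < 2 * q → ⌊ p /2⌋ < q
⌊p/2⌋<q p q p<2q = *-cancelˡ-< 2 _ _ (≤-<-trans (2⌊p/2⌋≤p p) p<2q)

doubling-bounds : ∀ p K → 2 ^ K ≤ ⌊ p /2⌋ → ⌊ p /2⌋ < 2 ^ suc K →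
                  2 ^ suc K ≤ p × p < 2 ^ suc (suc K)
doubling-bounds p K lower upper =
  ≤-trans (*-monoʳ-≤ 2 lower) (2⌊p/2⌋≤p p) ,
  <-≤-trans (p<2[1+⌊p/2⌋] p) (*-monoʳ-≤ 2 upper)

log₂-bounds : ∀ m → 1 ≤ m → 2 ^ ⌊log₂ m ⌋ ≤ m × m < 2 ^ suc ⌊log₂ m ⌋
log₂-bounds = <-rec (λ m → 1 ≤ m → 2 ^ ⌊log₂ m ⌋ ≤ m × m < 2 ^ suc ⌊log₂ m ⌋) bounds
  where
  bounds : ∀ m → (∀ {y} → y < m → 1 ≤ y → 2 ^ ⌊log₂ y ⌋ ≤ y × y < 2 ^ suc ⌊log₂ y ⌋) →
           1 ≤ m → 2 ^ ⌊log₂ m ⌋ ≤ m × m < 2 ^ suc ⌊log₂ m ⌋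
  bounds (suc zero)    _   _ = s≤s z≤n , s≤s (s≤s z≤n)
  bounds (suc (suc m)) rec _ =
    subst (λ k → 2 ^ k ≤ p × p < 2 ^ suc k) (sym log≡1+K)
      (doubling-bounds p K (subst (λ k → 2 ^ k ≤ ⌊ p /2⌋) log-half (proj₁ ih))
                           (subst (λ k → ⌊ p /2⌋ < 2 ^ suc k) log-half (proj₂ ih)))
    where
    p : ℕ
    p = suc (suc m)
    K : ℕ
    K = ⌊log₂ p ⌋ ∸ 1
    ih : 2 ^ ⌊log₂ ⌊ p /2⌋ ⌋ ≤ ⌊ p /2⌋ × ⌊ p /2⌋ < 2 ^ suc ⌊log₂ ⌊ p /2⌋ ⌋
    ih = rec (⌊n/2⌋<n (suc m)) (s≤s z≤n)
    log-half : ⌊log₂ ⌊ p /2⌋ ⌋ ≡ K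
    log-half = ⌊log₂⌊n/2⌋⌋≡⌊log₂n⌋∸1 p
    log≡1+K : ⌊log₂ p ⌋ ≡ suc K
    log≡1+K = sym (m+[n∸m]≡n (⌊log₂⌋-mono-≤ {2} {p} (s≤s (s≤s z≤n))))

follow-∷ʳ : ∀ {n m} (x : Input n m) c ds d {c′ c″} → follow x c ds ≡ just c′ →
            step d (x c′) ≡ just c″ → follow x c (ds ∷ʳ d) ≡ just c″
follow-∷ʳ x c []        d refl s rewrite s = refl
follow-∷ʳ x c (d′ ∷ ds) d p    s with step d′ (x c) | p
... | just c₁ | p′ = follow-∷ʳ x c₁ ds d p′ s
... | nothing | ()

parityDir : ℕ → Dir
parityDir p = if p % 2 ≡ᵇ 0 then left else right

child-position : ∀ k p → 2 * (2 ^ k + ⌊ p /2⌋) + p % 2 ≡ 2 ^ suc k + p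
child-position k p = begin
  2 * (2 ^ k + ⌊ p /2⌋) + p % 2         ≡⟨ cong (_+ p % 2) (*-distribˡ-+ 2 (2 ^ k) ⌊ p /2⌋) ⟩
  2 * 2 ^ k + 2 * ⌊ p /2⌋ + p % 2       ≡⟨ +-assoc (2 * 2 ^ k) _ _ ⟩
  2 * 2 ^ k + (2 * ⌊ p /2⌋ + p % 2)     ≡⟨ cong (2 * 2 ^ k +_) (halve-decomposition p) ⟩
  2 ^ suc k + p                          ∎
  where open ≡-Reasoning

-- Numbering nodes as in a heap (root 1, children of c
-- are 2c and 2c+1), the internal nodes are 1, …, m-1 and leaf j sits at
-- position leafCode j ≥ m, from which leafOf recovers j.
module LeafCodes (m : ℕ) (1≤m : 1 ≤ m) where

  k : ℕ
  k = ⌊log₂ m ⌋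

  P : ℕ
  P = 2 ^ k

  r : ℕ
  r = m ∸ P

  leafCode : ℕ → ℕ
  leafCode j = if j <ᵇ 2 * r then 2 * P + j else P + (j ∸ r)

  leafOf : ℕ → ℕ
  leafOf c with 2 * P ≤? c
  ... | yes _ = c ∸ 2 * P
  ... | no _  = c + r ∸ P

  P≤m : P ≤ m
  P≤m = proj₁ (log₂-bounds m 1≤m)

  P+r≡m : P + r ≡ m
  P+r≡m = m+[n∸m]≡n P≤m

  m<2P : m < 2 * P
  m<2P = proj₂ (log₂-bounds m 1≤m)

  r<P : r < P
  r<P = +-cancelˡ-< P r P (begin-strict
    P + r       ≡⟨ P+r≡m ⟩
    m           <⟨ m<2P ⟩
    2 * P       ≡⟨ cong (P +_) (+-identityʳ P) ⟩
    P + P       ∎)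
    where open ≤-Reasoning

  deep-leaf : ∀ j → j < 2 * r → m ≤ 2 * P + j × leafOf (2 * P + j) ≡ j
  deep-leaf j _ = ≤-trans (<⇒≤ m<2P) (m≤m+n _ j) , decode
    where
    decode : leafOf (2 * P + j) ≡ j
    decode with 2 * P ≤? 2 * P + j
    ... | yes _     = m+n∸m≡n (2 * P) j
    ... | no 2P≰2Pj = ⊥-elim (2P≰2Pj (m≤m+n _ _))

  shallow-leaf : ∀ j → j < m → 2 * r ≤ j → j ∸ r < P × m ≤ P + (j ∸ r) × leafOf (P + (j ∸ r)) ≡ j
  shallow-leaf j j<m 2r≤j = j∸r<P , m≤code , decode
    where
    r+r≤j : r + r ≤ j
    r+r≤j = subst (_≤ j) (cong (r +_) (+-identityʳ r)) 2r≤j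
    j∸r+r≡j : j ∸ r + r ≡ j
    j∸r+r≡j = m∸n+n≡m (m+n≤o⇒m≤o r r+r≤j)
    j∸r<P : j ∸ r < P
    j∸r<P = +-cancelʳ-< r (j ∸ r) P (subst₂ _<_ (sym j∸r+r≡j) (sym P+r≡m) j<m)
    m≤code : m ≤ P + (j ∸ r)
    m≤code = subst (_≤ P + (j ∸ r)) P+r≡m (+-monoʳ-≤ P (m+n≤o⇒m≤o∸n r r+r≤j))
    decode : leafOf (P + (j ∸ r)) ≡ j
    decode with 2 * P ≤? P + (j ∸ r)
    ... | yes 2P≤ = ⊥-elim (<⇒≱ (subst (P + (j ∸ r) <_) (cong (P +_) (sym (+-identityʳ P)))
                                        (+-monoʳ-< P j∸r<P)) 2P≤)
    ... | no _    = trans (cong (_∸ P) (+-assoc P (j ∸ r) r)) (trans (m+n∸m≡n P (j ∸ r + r)) j∸r+r≡j)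

  leafCode-valid : ∀ j → j < m → m ≤ leafCode j × leafOf (leafCode j) ≡ j
  leafCode-valid j j<m with j <ᵇ 2 * r in eq
  ... | true  = deep-leaf j (<ᵇ⇒< j (2 * r) (subst True (sym eq) _))
  ... | false = proj₂ (shallow-leaf j j<m (≮⇒≥ (λ lt → subst True eq (<⇒<ᵇ lt))))

-- A heap labelling of an input: node c is the cell playing heap position c.
module HeapLabelling {n m : ℕ} (x : Input n m) (node : ℕ → Cell n m) where

  HeapNode : ℕ → Set
  HeapNode c = lpoint (x (node c)) ≡ just (node (2 * c)) × rpoint (x (node c)) ≡ just (node (suc (2 * c)))

  step-parityDir : ∀ {c} p → HeapNode c → step (parityDir p) (x (node c)) ≡ just (node (2 * c + p % 2))
  step-parityDir {c} p (to-left , to-right) with parity p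
  ... | inj₁ (p%2 , _) rewrite p%2 | +-identityʳ (2 * c) = to-left
  ... | inj₂ (p%2 , _) rewrite p%2 | +-comm (2 * c) 1    = to-right

  follow-completePath : ∀ k p → p < 2 ^ k → (∀ c → 1 ≤ c → c < 2 ^ k → HeapNode c) →
                        follow x (node 1) (completePath k p) ≡ just (node (2 ^ k + p))
  follow-completePath zero    zero    _         _    = refl
  follow-completePath zero    (suc p) (s≤s ())  _
  follow-completePath (suc k) p       p<2^[1+k] heap =
    follow-∷ʳ x (node 1) (completePath k ⌊ p /2⌋) (parityDir p)
      (follow-completePath k ⌊ p /2⌋ half<2^k
        (λ c 1≤c c<2^k → heap c 1≤c (<-≤-trans c<2^k (m≤m+n (2 ^ k) _))))
      (trans (step-parityDir p (heap (2 ^ k + ⌊ p /2⌋) (≤-trans (m^n>0 2 k) (m≤m+n _ _)) parent<))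
             (cong (λ c → just (node c)) (child-position k p)))
    where
    half<2^k : ⌊ p /2⌋ < 2 ^ k
    half<2^k = ⌊p/2⌋<q p (2 ^ k) p<2^[1+k]
    parent< : 2 ^ k + ⌊ p /2⌋ < 2 ^ suc k
    parent< = subst (2 ^ k + ⌊ p /2⌋ <_) (cong (2 ^ k +_) (sym (+-identityʳ (2 ^ k))))
                    (+-monoʳ-< (2 ^ k) half<2^k)

  module _ (1≤m : 1 ≤ m) where
    open LeafCodes m 1≤m

    complete-internal : (∀ c → 1 ≤ c → c < m → HeapNode c) → ∀ c → 1 ≤ c → c < P → HeapNode c
    complete-internal heap c 1≤c c<P = heap c 1≤c (<-≤-trans c<P P≤m)

    follow-T : (∀ c → 1 ≤ c → c < m → HeapNode c) → ∀ (j : Fin m) →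
               follow x (node 1) (T m j) ≡ just (node (leafCode (toℕ j)))
    follow-T heap j with toℕ j <ᵇ 2 * r in eq
    ... | true  = follow-∷ʳ x (node 1) (completePath k ⌊ toℕ j /2⌋) (parityDir (toℕ j))
                    (follow-completePath k ⌊ toℕ j /2⌋ (<-trans half<r r<P) (complete-internal heap))
                    (trans (step-parityDir (toℕ j) (heap (P + ⌊ toℕ j /2⌋) (≤-trans (m^n>0 2 k) (m≤m+n P _)) parent<m))
                           (cong (λ c → just (node c)) (child-position k (toℕ j))))
      where
      half<r : ⌊ toℕ j /2⌋ < r
      half<r = ⌊p/2⌋<q (toℕ j) r (<ᵇ⇒< (toℕ j) (2 * r) (subst True (sym eq) _))
      parent<m : P + ⌊ toℕ j /2⌋ < m
      parent<m = subst (P + ⌊ toℕ j /2⌋ <_) P+r≡m (+-monoʳ-< P half<r)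
    ... | false = follow-completePath k (toℕ j ∸ r) (proj₁ (shallow-leaf (toℕ j) (Fin.toℕ<n j) 2r≤j))
                    (complete-internal heap)
      where
      2r≤j : 2 * r ≤ toℕ j
      2r≤j = ≮⇒≥ (λ lt → subst True eq (<⇒<ᵇ lt))

-- A history lists queried cells with the answers they received, newest first.
History : ℕ → ℕ → Set
History n m = List (Cell n m × Sym n m)

module _ {n m : ℕ} where

  _≟ᶜ_ : (c d : Cell n m) → Dec (c ≡ d)
  _≟ᶜ_ = ≡-dec Fin._≟_ Fin._≟_

  recorded : Cell n m → History n m → Maybe (Sym n m)
  recorded c [] = nothing
  recorded c ((c′ , s) ∷ H) with c ≟ᶜ c′
  ... | yes _ = just s
  ... | no _  = recorded c H

  Distinct : History n m → Set
  Distinct H = Unique (map proj₁ H)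

  recorded-sound : ∀ c H {s} → recorded c H ≡ just s → (c , s) ∈ H
  recorded-sound c ((c′ , s′) ∷ H) eq with c ≟ᶜ c′
  recorded-sound c ((c  , s′) ∷ H) refl | yes refl = here refl
  ... | no _ = there (recorded-sound c H eq)

  recorded-complete : ∀ H {c s} → Distinct H → (c , s) ∈ H → recorded c H ≡ just s
  recorded-complete ((c′ , s′) ∷ H) {c} (c′∉H ∷ _) (here refl) with c ≟ᶜ c
  ... | yes _ = refl
  ... | no c≢c = ⊥-elim (c≢c refl)
  recorded-complete ((c′ , s′) ∷ H) {c} (c′∉H ∷ uH) (there p) with c ≟ᶜ c′
  ... | yes refl = ⊥-elim (All.lookup c′∉H (∈-map⁺ proj₁ p) refl)
  ... | no _     = recorded-complete H uH p

  recorded-nothing : ∀ c H → recorded c H ≡ nothing → c ∉ map proj₁ H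
  recorded-nothing c ((c′ , s′) ∷ H) eq c∈ with c ≟ᶜ c′ | c∈
  ... | yes _   | _         = case eq of λ ()
  ... | no c≢c′ | here c≡c′ = c≢c′ c≡c′
  ... | no _    | there c∈H = recorded-nothing c H eq c∈H

  Agrees : Input n m → History n m → Set
  Agrees x H = All (λ e → x (proj₁ e) ≡ proj₂ e) H

  agrees-with-recorded : ∀ x H → Distinct H → (∀ c s → recorded c H ≡ just s → x c ≡ s) → Agrees x H
  agrees-with-recorded x H uH agree = All.tabulate (λ e∈H → agree _ _ (recorded-complete H uH e∈H))

module Run {n m : ℕ} (answer : Cell n m → History n m → Sym n m) where

  run : DTree n m → History n m → History n m
  run (leaf _)    H = H
  run (query c k) H with recorded c H
  ... | just s  = run (k s) H
  ... | nothing = run (k (answer c H)) ((c , answer c H) ∷ H)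

  run-extends : ∀ t H x → Agrees x (run t H) → Agrees x H
  run-extends (leaf _)    H x ag = ag
  run-extends (query c k) H x ag with recorded c H
  ... | just s  = run-extends (k s) H x ag
  ... | nothing with run-extends (k (answer c H)) _ x ag
  ...   | _ ∷ agH = agH

  run-decides : ∀ t H x y → Agrees x (run t H) → Agrees y (run t H) → eval t x ≡ eval t y
  run-decides (leaf _)    H x y agx agy = refl
  run-decides (query c k) H x y agx agy with recorded c H in eq
  ... | just s rewrite All.lookup (run-extends (k s) H x agx) (recorded-sound c H eq)
                     | All.lookup (run-extends (k s) H y agy) (recorded-sound c H eq)
                     = run-decides (k s) H x y agx agy
  ... | nothing with run-extends (k (answer c H)) _ x agx | run-extends (k (answer c H)) _ y agy
  ...   | xc ∷ _ | yc ∷ _ rewrite xc | yc = run-decides (k (answer c H)) _ x y agx agy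

  -- Each new entry of the run is a query made on such an input.
  run-length : ∀ t H x → Agrees x (run t H) → length (run t H) ≤ cost t x + length H
  run-length (leaf _)    H x ag = ≤-refl
  run-length (query c k) H x ag with recorded c H in eq
  ... | just s rewrite All.lookup (run-extends (k s) H x ag) (recorded-sound c H eq)
                     = m≤n⇒m≤1+n (run-length (k s) H x ag)
  ... | nothing with run-extends (k (answer c H)) _ x ag
  ...   | xc ∷ _ rewrite xc = ≤-trans (run-length (k (answer c H)) _ x ag) (≤-reflexive (+-suc _ _))

  -- Only new cells are added, so the final history has distinct cells.
  run-distinct : ∀ t H → Distinct H → Distinct (run t H)
  run-distinct (leaf _)    H uH = uH
  run-distinct (query c k) H uH with recorded c H in eq
  ... | just s  = run-distinct (k s) H uH
  ... | nothing = run-distinct (k (answer c H)) _ (¬Any⇒All¬ _ (recorded-nothing c H eq) ∷ uH)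

module Adversary (n m′ : ℕ) where

  m : ℕ
  m = suc m′

  open LabelCounting {A = Cell n m × Sym n m} (λ e → col (proj₁ e)) public

  -- the column with a given number, defaulting to column 0 out of range
  toColumn : ℕ → Fin m
  toColumn k with k <? m
  ... | yes k<m = fromℕ< k<m
  ... | no _    = Fin.zero

  toColumn-toℕ : ∀ j → toColumn (toℕ j) ≡ j
  toColumn-toℕ j with toℕ j <? m
  ... | yes j<m = Fin.fromℕ<-toℕ j j<m
  ... | no j≮m  = ⊥-elim (j≮m (Fin.toℕ<n j))

  response : ℕ → Sym n m
  response k with k <? m
  ... | yes _ = plain
  ... | no _  = false , nothing , nothing , just (toColumn (k ∸ m))

  response-plain : ∀ k → k < m → response k ≡ plain
  response-plain k k<m with k <? m
  ... | yes _   = refl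
  ... | no k≮m  = ⊥-elim (k≮m k<m)

  response-pointer : ∀ k → m ≤ k → response k ≡ (false , nothing , nothing , just (toColumn (k ∸ m)))
  response-pointer k m≤k with k <? m
  ... | yes k<m = ⊥-elim (<⇒≱ k<m m≤k)
  ... | no _    = refl

  -- the first k answers of a column, newest first
  responses : ℕ → List (Sym n m)
  responses zero    = []
  responses (suc k) = response k ∷ responses k

  ∈-responses⁺ : ∀ i k → i < k → response i ∈ responses k
  ∈-responses⁺ i (suc k) i<1+k with m≤n⇒m<n∨m≡n (s≤s⁻¹ i<1+k)
  ... | inj₁ i<k  = there (∈-responses⁺ i k i<k)
  ... | inj₂ refl = here refl

  ∈-responses⁻ : ∀ s k → s ∈ responses k → ∃[ i ] (i < k × s ≡ response i)
  ∈-responses⁻ s (suc k) (here s≡) = k , ≤-refl , s≡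
  ∈-responses⁻ s (suc k) (there s∈) with ∈-responses⁻ s k s∈
  ... | i , i<k , s≡ = i , m≤n⇒m≤1+n i<k , s≡

  adversary : Cell n m → History n m → Sym n m
  adversary c H = response (occurrences (col c) H)

  open Run adversary public

  Produced : History n m → Set
  Produced H = ∀ j → map proj₂ (withLabel j H) ≡ responses (occurrences j H)

  produced-run : ∀ t H → Produced H → Produced (run t H)
  produced-run (leaf _)    H prod = prod
  produced-run (query c k) H prod with recorded c H
  ... | just s  = produced-run (k s) H prod
  ... | nothing = produced-run (k (adversary c H)) _ extended
    where
    extended : Produced ((c , adversary c H) ∷ H)
    extended j with col c Fin.≟ j
    ... | yes refl = cong (adversary c H ∷_) (prod (col c))
    ... | no _     = prod j

  module _ {H : History n m} (prod : Produced H) where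

    entry-with-response : ∀ j k → k < occurrences j H → ∃[ i ] (((i , j) , response k) ∈ H)
    entry-with-response j k k<occ
      with ∈-map⁻ proj₂ (subst (response k ∈_) (sym (prod j)) (∈-responses⁺ k (occurrences j H) k<occ))
    ... | e , e∈ , refl with ∈-filter⁻ (λ e → col (proj₁ e) Fin.≟ j) {xs = H} e∈
    ...   | e∈H , refl = proj₁ (proj₁ e) , e∈H

    response-of-entry : ∀ e → e ∈ H → ∃[ i ] (i < occurrences (col (proj₁ e)) H × proj₂ e ≡ response i)
    response-of-entry e e∈H = ∈-responses⁻ (proj₂ e) _ (subst (proj₂ e ∈_) (prod (col (proj₁ e)))
      (∈-map⁺ proj₂ (∈-filter⁺ (λ e′ → col (proj₁ e′) Fin.≟ col (proj₁ e)) e∈H refl)))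

-- 3m + m² ≤ 2m² once m ≥ 3: enough unqueried cells remain for T.
room-for-internal-nodes : ∀ m → 3 ≤ m → m + (m * m + 2 * m) ≤ 2 * m * m
room-for-internal-nodes m 3≤m = begin
  m + (m * m + 2 * m)    ≡⟨ regroup m ⟩
  3 * m + m * m          ≤⟨ +-monoˡ-≤ (m * m) (*-monoˡ-≤ m 3≤m) ⟩
  m * m + m * m          ≡⟨ double m ⟩
  2 * m * m              ∎
  where
  open ≤-Reasoning
  regroup : ∀ m → m + (m * m + 2 * m) ≡ 3 * m + m * m
  regroup = solve-∀
  double : ∀ m → m * m + m * m ≡ 2 * m * m
  double = solve-∀

true≢false : true ≢ false
true≢false ()

-- H is the final history of a run against the adversary on the n × m grid
-- with n = 2m.
module Indistinguishable (m′ : ℕ) (H : History (2 * suc m′) (suc m′))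
                         (distinct : Distinct H) (prod : Adversary.Produced (2 * suc m′) m′ H) where
  open Adversary (2 * suc m′) m′

  n : ℕ
  n = 2 * m

  -- the m-th query into a column is possible, since a column has n > m cells
  m<n : m < n
  m<n = m<m+n m (s≤s z≤n)

  Unqueried : Cell n m → Set
  Unqueried c = recorded c H ≡ nothing

  unqueried? : ∀ c → Dec (Unqueried c)
  unqueried? c with recorded c H
  ... | nothing = yes refl
  ... | just _  = no λ ()

  queried-entry : ∀ c → ¬ Unqueried c → ∃[ s ] ((c , s) ∈ H)
  queried-entry c queried with recorded c H in eq
  ... | nothing = ⊥-elim (queried refl)
  ... | just s  = s , recorded-sound c H eq

  OpenColumn : Fin m → Set
  OpenColumn j = ∃[ i ] Unqueried (i , j)

  open-column? : ∀ j → Dec (OpenColumn j)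
  open-column? j = Fin.any? (λ i → unqueried? (i , j))

  columnCells : Fin m → List (Cell n m)
  columnCells j = map (_, j) (allFin n)

  length-columnCells : ∀ j → length (columnCells j) ≡ n
  length-columnCells j = trans (length-map _ (allFin n)) (length-allFin n)

  closed-column : ∀ j → ¬ OpenColumn j → n ≤ occurrences j H
  closed-column j closed = subst₂ _≤_ (length-columnCells j) (length-map proj₁ (withLabel j H))
    (unique-⊆⇒length-≤ (map⁺ (cong proj₁) (allFin⁺ n)) queried)
    where
    queried : columnCells j ⊆ map proj₁ (withLabel j H)
    queried c∈ with ∈-map⁻ (_, j) c∈
    ... | i , _ , refl = ∈-map⁺ proj₁ (∈-filter⁺ (λ e → col (proj₁ e) Fin.≟ j)
                                        (proj₂ (queried-entry (i , j) (λ u → closed (i , u)))) refl)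

  x₀ : Input n m
  x₀ c with recorded c H
  ... | just s  = s
  ... | nothing = false , nothing , nothing , nothing

  x₀-recorded : ∀ {c s} → recorded c H ≡ just s → x₀ c ≡ s
  x₀-recorded eq rewrite eq = refl

  x₀-agrees : Agrees x₀ H
  x₀-agrees = agrees-with-recorded x₀ H distinct (λ _ _ → x₀-recorded)

  -- f(x₀) = 0: the marked column cannot contain an unqueried 0-cell, so it
  -- is closed; but then its query number m was answered with a 0-cell.
  x₀-rejected : ¬ f x₀
  x₀-rejected fx with open-column? (FValue.b fx)
  ... | yes (i , unqueried) = true≢false (trans (sym (FValue.marked fx i)) (val-unqueried unqueried))
    where
    val-unqueried : ∀ {c} → Unqueried c → val (x₀ c) ≡ false
    val-unqueried {c} eq rewrite eq = refl
  ... | no closed with entry-with-response prod (FValue.b fx) m (<-≤-trans m<n (closed-column _ closed))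
  ...   | i , e∈H = true≢false (begin
    true                                     ≡⟨ FValue.marked fx i ⟨
    val (x₀ (i , FValue.b fx))               ≡⟨ cong val (x₀-recorded (recorded-complete H distinct e∈H)) ⟩
    val (response m)                         ≡⟨ cong val (response-pointer m ≤-refl) ⟩
    false                                    ∎)
    where open ≡-Reasoning

  -- If fewer than m² queries were made (and m ≥ 3), H also extends to an
  -- input x₁ with f(x₁) = 1.
  module Accepting (short : length H < m * m) (3≤m : 3 ≤ m) where

    -- The choices below are opaque: only their stated properties matter,
    -- and unfolding them would make type checking needlessly expensive.

    opaque
      b : Fin m
      b = proj₁ (rare-label m H short)

      b-rare : occurrences b H < m
      b-rare = proj₂ (rare-label m H short)

    column-b-plain : ∀ {i s} → ((i , b) , s) ∈ H → s ≡ plain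
    column-b-plain e∈H with response-of-entry prod _ e∈H
    ... | k , k<occ , refl = response-plain k (<-trans k<occ b-rare)

    opaque
      a-row : OpenColumn b
      a-row with open-column? b
      ... | yes open-b = open-b
      ... | no closed  = ⊥-elim (<⇒≱ b-rare (≤-trans (<⇒≤ m<n) (closed-column b closed)))

    a : Cell n m
    a = proj₁ a-row , b

    -- the leaf of column j: an unqueried cell, or, if the column is closed,
    -- the cell that received response (m + b), a 0-cell pointing to b
    opaque
      leaf-row : ∀ j → ∃[ i ] (Unqueried (i , j) ⊎ (((i , j) , response (m + toℕ b)) ∈ H))
      leaf-row j with open-column? j
      ... | yes (i , unqueried) = i , inj₁ unqueried
      ... | no closed with entry-with-response prod j (m + toℕ b) (<-≤-trans m+b<n (closed-column j closed))
        where
        m+b<n : m + toℕ b < n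
        m+b<n = subst (m + toℕ b <_) (cong (m +_) (sym (+-identityʳ m))) (+-monoʳ-< m (Fin.toℕ<n b))
      ...   | i , e∈H = i , inj₂ e∈H

    leafCell : Fin m → Cell n m
    leafCell j = proj₁ (leaf-row j) , j

    -- cells available for the internal nodes of T: unqueried, outside column b
    Spare : Cell n m → Set
    Spare c = Unqueried c × col c ≢ b

    spare? : ∀ c → Dec (Spare c)
    spare? c = unqueried? c ×-dec ¬? (col c Fin.≟ b)

    spareCells : List (Cell n m)
    spareCells = filter spare? (grid n m)

    otherCells : List (Cell n m)
    otherCells = filter (λ c → ¬? (spare? c)) (grid n m)

    otherCells-⊆ : otherCells ⊆ map proj₁ H ++ columnCells b
    otherCells-⊆ {i , j} c∈ with unqueried? (i , j) | j Fin.≟ b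
    ... | no queried | _        = ∈-++⁺ˡ (∈-map⁺ proj₁ (proj₂ (queried-entry (i , j) queried)))
    ... | yes _      | yes refl = ∈-++⁺ʳ (map proj₁ H) (∈-map⁺ (_, b) (∈-allFin i))
    ... | yes u      | no j≢b   = ⊥-elim (proj₂ (∈-filter⁻ (λ c → ¬? (spare? c)) {xs = grid n m} c∈) (u , j≢b))

    length-otherCells : length otherCells ≤ length H + n
    length-otherCells = begin
      length otherCells                               ≤⟨ unique-⊆⇒length-≤ (filter⁺ (λ c → ¬? (spare? c)) (grid-unique n m)) otherCells-⊆ ⟩
      length (map proj₁ H ++ columnCells b)           ≡⟨ length-++ (map proj₁ H) ⟩
      length (map proj₁ H) + length (columnCells b)   ≡⟨ cong₂ _+_ (length-map proj₁ H) (length-columnCells b) ⟩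
      length H + n                                    ∎
      where open ≤-Reasoning

    -- Fewer than m² of the 2m² cells were queried and only 2m lie in
    -- column b, so at least m cells are spare.
    many-spare : m ≤ length spareCells
    many-spare = ≮⇒≥ λ few → <-irrefl refl (begin-strict
      n * m                                      ≡⟨ length-grid n m ⟨
      length (grid n m)                          ≡⟨ length-filter-partition spare? (grid n m) ⟨
      length spareCells + length otherCells      <⟨ +-mono-<-≤ few length-otherCells ⟩
      m + (length H + n)                         ≤⟨ +-monoʳ-≤ m (+-monoˡ-≤ n (<⇒≤ short)) ⟩
      m + (m * m + n)                            ≤⟨ room-for-internal-nodes m 3≤m ⟩
      n * m                                      ∎)
      where open ≤-Reasoning

    -- the internal node at heap position 2 + i occupies the i-th spare cell
    internal : ℕ → Cell n m
    internal i = nth spareCells a i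

    internal-spare : ∀ i → i < length spareCells → Spare (internal i)
    internal-spare i i< = proj₂ (∈-filter⁻ spare? {xs = grid n m} (nth-∈ spareCells a i i<))

    internalIndex : ℕ → Cell n m → Maybe ℕ
    internalIndex zero        c = nothing
    internalIndex (suc bound) c with internal bound ≟ᶜ c
    ... | yes _ = just bound
    ... | no _  = internalIndex bound c

    internalIndex-internal : ∀ bound i → bound ≤ length spareCells → i < bound →
                             internalIndex bound (internal i) ≡ just i
    internalIndex-internal (suc bound) i bound≤ i<1+bound with internal bound ≟ᶜ internal i
    ... | yes same = cong just (nth-injective spareCells a (filter⁺ spare? (grid-unique n m))
                                 bound≤ (<-≤-trans i<1+bound bound≤) same)
    ... | no differ with m≤n⇒m<n∨m≡n (s≤s⁻¹ i<1+bound)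
    ...   | inj₁ i<bound = internalIndex-internal bound i (<⇒≤ bound≤) i<bound
    ...   | inj₂ refl    = ⊥-elim (differ refl)

    open LeafCodes m (s≤s z≤n) using (leafCode; leafOf; leafCode-valid)

    -- The heap labelling: position 1 is the special element, positions
    -- 2 … m-1 are internal nodes, positions ≥ m are leaves (position 0 is
    -- never used).
    node : ℕ → Cell n m
    node zero          = a
    node (suc zero)    = a
    node (suc (suc i)) with suc (suc i) <? m
    ... | yes _ = internal i
    ... | no _  = leafCell (toColumn (leafOf (suc (suc i))))

    node-internal : ∀ i → 2 + i < m → node (2 + i) ≡ internal i
    node-internal i 2+i<m with suc (suc i) <? m
    ... | yes _    = refl
    ... | no 2+i≮m = ⊥-elim (2+i≮m 2+i<m)

    node-leaf : ∀ c → m ≤ c → node c ≡ leafCell (toColumn (leafOf c))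
    node-leaf (suc (suc i)) m≤c with suc (suc i) <? m
    ... | yes c<m = ⊥-elim (<⇒≱ c<m m≤c)
    ... | no _    = refl
    node-leaf zero          m≤c = ⊥-elim (<⇒≱ (s≤s z≤n) m≤c)
    node-leaf (suc zero)    m≤c = ⊥-elim (<⇒≱ (≤-trans (s≤s (s≤s z≤n)) 3≤m) m≤c)

    root : Sym n m
    root = true , just (node 2) , just (node 3) , nothing

    -- the symbol of an unqueried cell outside column b: a 0-cell pointing to
    -- b, which also points to the children of heap position 2 + i if it is
    -- the internal node i
    branch : Maybe ℕ → Sym n m
    branch nothing  = false , nothing , nothing , just b
    branch (just i) = false , just (node (2 * (2 + i))) , just (node (suc (2 * (2 + i)))) , just b

    x₁ : Input n m
    x₁ c with recorded c H
    ... | just s  = s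
    ... | nothing with col c Fin.≟ b
    ...   | no _  = branch (internalIndex (m ∸ 2) c)
    ...   | yes _ with c ≟ᶜ a
    ...     | yes _ = root
    ...     | no _  = plain

    x₁-recorded : ∀ {c s} → recorded c H ≡ just s → x₁ c ≡ s
    x₁-recorded eq rewrite eq = refl

    x₁-agrees : Agrees x₁ H
    x₁-agrees = agrees-with-recorded x₁ H distinct (λ _ _ → x₁-recorded)

    x₁-outside-b : ∀ {c} → Unqueried c → col c ≢ b → x₁ c ≡ branch (internalIndex (m ∸ 2) c)
    x₁-outside-b {c} eq c∉b rewrite eq with col c Fin.≟ b
    ... | yes c∈b = ⊥-elim (c∉b c∈b)
    ... | no _    = refl

    x₁-column-b : ∀ {i} → Unqueried (i , b) → ((i , b) ≡ a × x₁ (i , b) ≡ root) ⊎ ((i , b) ≢ a × x₁ (i , b) ≡ plain)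
    x₁-column-b {i} eq rewrite eq with b Fin.≟ b
    ... | no b≢b = ⊥-elim (b≢b refl)
    ... | yes _ with (i , b) ≟ᶜ a
    ...   | yes c≡a = inj₁ (c≡a , refl)
    ...   | no c≢a  = inj₂ (c≢a , refl)

    x₁-a : x₁ a ≡ root
    x₁-a with x₁-column-b (proj₂ a-row)
    ... | inj₁ (_ , x₁a≡root) = x₁a≡root
    ... | inj₂ (a≢a , _)      = ⊥-elim (a≢a refl)

    column-b : ∀ i → (x₁ (i , b) ≡ plain) ⊎ ((i , b) ≡ a × x₁ (i , b) ≡ root)
    column-b i with unqueried? (i , b)
    ... | no queried with queried-entry (i , b) queried
    ...   | s , e∈H = inj₁ (trans (x₁-recorded (recorded-complete H distinct e∈H)) (column-b-plain e∈H))
    column-b i | yes unqueried with x₁-column-b unqueried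
    ...   | inj₁ is-root          = inj₂ is-root
    ...   | inj₂ (_ , is-plain)   = inj₁ is-plain

    leaf-points-to-b : ∀ j → j ≢ b → val (x₁ (leafCell j)) ≡ false × bpoint (x₁ (leafCell j)) ≡ just b
    leaf-points-to-b j j≢b with proj₂ (leaf-row j)
    ... | inj₁ unqueried rewrite x₁-outside-b unqueried j≢b = branch-leaf (internalIndex (m ∸ 2) (leafCell j))
      where
      branch-leaf : ∀ mi → val (branch mi) ≡ false × bpoint (branch mi) ≡ just b
      branch-leaf nothing  = refl , refl
      branch-leaf (just _) = refl , refl
    ... | inj₂ e∈H rewrite x₁-recorded (recorded-complete H distinct e∈H)
                         | response-pointer (m + toℕ b) (m≤m+n m (toℕ b))
                         | m+n∸m≡n m (toℕ b) | toColumn-toℕ b = refl , refl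

    x₁-internal : ∀ i → i < m ∸ 2 → x₁ (internal i) ≡ branch (just i)
    x₁-internal i i<m∸2 = begin
      x₁ (internal i)                                   ≡⟨ x₁-outside-b (proj₁ spare) (proj₂ spare) ⟩
      branch (internalIndex (m ∸ 2) (internal i))       ≡⟨ cong branch (internalIndex-internal (m ∸ 2) i enough i<m∸2) ⟩
      branch (just i)                                   ∎
      where
      open ≡-Reasoning
      enough : m ∸ 2 ≤ length spareCells
      enough = ≤-trans (m∸n≤m m 2) many-spare
      spare : Spare (internal i)
      spare = internal-spare i (<-≤-trans i<m∸2 enough)

    heap : ∀ c → 1 ≤ c → c < m → HeapLabelling.HeapNode x₁ node c
    heap (suc zero)    _ _   rewrite x₁-a = refl , refl
    heap (suc (suc i)) _ c<m rewrite node-internal i c<m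
                                   | x₁-internal i (∸-monoˡ-< c<m (s≤s (s≤s z≤n))) = refl , refl

    x₁-accepted : f x₁
    x₁-accepted = record
      { b           = b
      ; marked      = λ i → marked (column-b i)
      ; markedUniq  = only-b-marked
      ; a           = proj₁ a-row
      ; special     = λ x₁a≡plain → root≢plain (trans (sym x₁-a) x₁a≡plain)
      ; specialUniq = only-a-special
      ; paths       = λ j j≢b → leafCell j , reaches-leaf j , refl , leaf-points-to-b j j≢b
      }
      where
      marked : ∀ {i} → (x₁ (i , b) ≡ plain) ⊎ ((i , b) ≡ a × x₁ (i , b) ≡ root) → val (x₁ (i , b)) ≡ true
      marked (inj₁ is-plain)     = cong val is-plain
      marked (inj₂ (_ , is-root)) = cong val is-root

      only-b-marked : ∀ j → (∀ i → val (x₁ (i , j)) ≡ true) → j ≡ b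
      only-b-marked j all-true with j Fin.≟ b
      ... | yes j≡b = j≡b
      ... | no j≢b  = ⊥-elim (true≢false (trans (sym (all-true (proj₁ (leaf-row j))))
                                                 (proj₁ (leaf-points-to-b j j≢b))))

      root≢plain : root ≢ plain
      root≢plain ()

      only-a-special : ∀ i → x₁ (i , b) ≢ plain → i ≡ proj₁ a-row
      only-a-special i not-plain with column-b i
      ... | inj₁ is-plain     = ⊥-elim (not-plain is-plain)
      ... | inj₂ (is-a , _)   = cong proj₁ is-a

      reaches-leaf : ∀ j → follow x₁ a (T m j) ≡ just (leafCell j)
      reaches-leaf j = begin
        follow x₁ (node 1) (T m j)                                ≡⟨ HeapLabelling.follow-T x₁ node (s≤s z≤n) heap j ⟩
        just (node (leafCode (toℕ j)))                            ≡⟨ cong just (node-leaf _ (proj₁ valid)) ⟩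
        just (leafCell (toColumn (leafOf (leafCode (toℕ j)))))    ≡⟨ cong (λ k → just (leafCell (toColumn k))) (proj₂ valid) ⟩
        just (leafCell (toColumn (toℕ j)))                        ≡⟨ cong (λ j′ → just (leafCell j′)) (toColumn-toℕ j) ⟩
        just (leafCell j)                                         ∎
        where
        open ≡-Reasoning
        valid : m ≤ leafCode (toℕ j) × leafOf (leafCode (toℕ j)) ≡ toℕ j
        valid = leafCode-valid (toℕ j) (Fin.toℕ<n j)

theorem2 : ∃[ M₀ ] (∀ (m : ℕ) → 0 < m → M₀ ≤ m →
    ∀ (t : DTree (2 * m) m) → Computes t →
    ∃[ x ] (m * m ≤ cost t x))
theorem2 = 3 , lower-bound
  where
  lower-bound : ∀ (m : ℕ) → 0 < m → 3 ≤ m → ∀ (t : DTree (2 * m) m) → Computes t → ∃[ x ] (m * m ≤ cost t x)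
  lower-bound (suc m′) _ 3≤m t computes = x₀ , many-queries
    where
    open Adversary (2 * suc m′) m′ using (run; run-distinct; produced-run; run-decides; run-length)
    open Indistinguishable m′ (run t []) (run-distinct t [] []) (produced-run t [] (λ _ → refl))

    many-queries : suc m′ * suc m′ ≤ cost t x₀
    many-queries with suc m′ * suc m′ ≤? cost t x₀
    ... | yes enough = enough
    ... | no few     = ⊥-elim (x₀-rejected (proj₁ (computes x₀) (begin
      eval t x₀   ≡⟨ run-decides t [] x₀ x₁ x₀-agrees x₁-agrees ⟩
      eval t x₁   ≡⟨ proj₂ (computes x₁) x₁-accepted ⟩
      true        ∎)))
      where
      open ≡-Reasoning
      short : length (run t []) < suc m′ * suc m′
      short = ≤-<-trans (subst (length (run t []) ≤_) (+-identityʳ _) (run-length t [] x₀ x₀-agrees)) (≰⇒> few)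
      open Accepting short 3≤m
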